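{- Let $T$ be a string, $a$ a character and $x$ a string. If $ax \notin \mathsf{M}(T)$ and $ax \in \mathsf{M}(aT)$, then $x \in \mathsf{M}(T)$ and $d_{aT}(ax) \leq d_T(x)$.
   Context: Strings are finite sequences of characters from an alphabet $\Sigma$; $\varepsilon$ is the empty string. For a string $T$, $\mathrm{Substr}(T)$ is its set of substrings (including $\varepsilon$). A substring $u$ of $T$ is left-maximal in $T$ if $u$ is a prefix of $T$ or there are distinct characters $c \neq d$ with $cu, du \in \mathrm{Substr}(T)$; it is right-maximal in $T$ if $u$ is a suffix of $T$ or there are distinct characters $c\neq d$ with $uc, ud \in \mathrm{Substr}(T)$. $\mathsf{M}(T)$ is the set of substrings of $T$ that are both left- and right-maximal (the nodes of the CDAWG of $T$). For a string $w$, $d_T(w)$ is the number of distinct characters $c$ with $wc \in \mathrm{Substr}(T)$ (for $w\in\mathsf{M}(T)$, the out-degree of node $w$ in the CDAWG of $T$). -}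

module Defs where

open import Level using (Level)
open import Data.Nat.Base using (ℕ)
open import Data.List.Base using (List; []; _∷_; _++_; [_]; length; filter; deduplicate)
open import Data.Product using (∃; ∃-syntax; _×_; _,_)
open import Relation.Binary.PropositionalEquality using (_≡_)
open import Relation.Binary.Definitions using (DecidableEquality)
open import Relation.Nullary using (¬_)
open import Data.List.Relation.Binary.Infix.Heterogeneous using (Infix)
open import Data.List.Relation.Binary.Infix.Heterogeneous.Properties using (infix?)

module Strings {ℓ : Level} {Σ : Set ℓ} (_≟_ : DecidableEquality Σ) where

  String : Set ℓ
  String = List Σ

  Substr : String → String → Set ℓ
  Substr T u = ∃[ l ] ∃[ r ] T ≡ l ++ u ++ r

  IsPrefix : String → String → Set ℓ
  IsPrefix T u = ∃[ r ] T ≡ u ++ r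

  IsSuffix : String → String → Set ℓ
  IsSuffix T u = ∃[ l ] T ≡ l ++ u

  LeftMaximal : String → String → Set ℓ
  LeftMaximal T u =
    IsPrefix T u ⊎' (∃[ c ] ∃[ d ] (¬ c ≡ d) × Substr T (c ∷ u) × Substr T (d ∷ u))
    where open import Data.Sum using () renaming (_⊎_ to _⊎'_)

  RightMaximal : String → String → Set ℓ
  RightMaximal T u =
    IsSuffix T u ⊎' (∃[ c ] ∃[ d ] (¬ c ≡ d) × Substr T (u ++ [ c ]) × Substr T (u ++ [ d ]))
    where open import Data.Sum using () renaming (_⊎_ to _⊎'_)

  M : String → String → Set ℓ
  M T u = Substr T u × LeftMaximal T u × RightMaximal T u

  substr? : (u T : String) → Relation.Nullary.Dec (Infix _≡_ u T)
  substr? u T = infix? _≟_ u T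

  -- d_T(w): number of distinct characters c with wc ∈ Substr(T).
  -- Any such c occurs in T, so we filter the characters of T and deduplicate.
  d : String → String → ℕ
  d T w = length (deduplicate _≟_ (filter (λ c → substr? (w ++ [ c ]) T) T))

-- If ax is maximal in aT but not in T, the maximality of ax in aT must be witnessed by
-- its occurrence as a prefix of aT: every other occurrence, left context or right
-- extension of ax in aT already lies inside T. Hence x is a prefix of T, so it is
-- left-maximal, and it inherits right-maximality from ax. Likewise every character
-- extending ax in aT also extends x in T, which bounds the out-degrees.
module Submission where

open import Defs
open import Level using (Level)
open import Data.Nat.Base using (suc; _≤_; z≤n; s≤s)
open import Data.Nat.Properties using (module ≤-Reasoning)
open import Data.List.Base using (List; []; _∷_; _++_; [_]; length; filter; deduplicate)
open import Data.List.Properties using (++-assoc; ++-identityʳ; length-removeAt′)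
open import Data.Product using (_×_; _,_)
open import Data.Sum using (_⊎_; inj₁; inj₂)
open import Relation.Nullary using (¬_; contradiction)
open import Relation.Binary.Definitions using (DecidableEquality)
open import Relation.Binary.PropositionalEquality using (_≡_; _≢_; refl; sym; cong; ≢-sym)
open import Data.List.Membership.Propositional using (_∈_)
open import Data.List.Membership.Propositional.Properties using (∈-++⁺ˡ; ∈-++⁺ʳ; ∈-filter⁻; ∈-filter⁺; ∈-deduplicate⁻; ∈-deduplicate⁺)
open import Data.List.Relation.Binary.Subset.Propositional using (_⊆_)
open import Data.List.Relation.Unary.Any using (here; there; index; _─_)
open import Data.List.Relation.Unary.All as All using ()
open import Data.List.Relation.Unary.AllPairs using (_∷_)
open import Data.List.Relation.Unary.Unique.Propositional using (Unique)
open import Data.List.Relation.Unary.Unique.DecPropositional.Properties using (deduplicate-!)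
open import Data.List.Relation.Binary.Pointwise using (Pointwise-≡⇒≡; ≡⇒Pointwise-≡)
open import Data.List.Relation.Binary.Infix.Heterogeneous using (Infix; MkView; toView; fromView)

module _ {ℓ : Level} {A : Set ℓ} where

  ∈-─⁺ : ∀ {x y : A} {ys} (x∈ys : x ∈ ys) → y ∈ ys → y ≢ x → y ∈ (ys ─ x∈ys)
  ∈-─⁺ (here refl)  (here refl)  y≢x = contradiction refl y≢x
  ∈-─⁺ (here _)     (there y∈ys) _   = y∈ys
  ∈-─⁺ (there _)    (here y≡)    _   = here y≡
  ∈-─⁺ (there x∈ys) (there y∈ys) y≢x = there (∈-─⁺ x∈ys y∈ys y≢x)

  Unique-⊆⇒length-≤ : ∀ {xs ys : List A} → Unique xs → xs ⊆ ys → length xs ≤ length ys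
  Unique-⊆⇒length-≤ {[]}     _                 _     = z≤n
  Unique-⊆⇒length-≤ {x ∷ xs} {ys} (x∉xs ∷ !xs) xs⊆ys = begin
    suc (length xs)          ≤⟨ s≤s (Unique-⊆⇒length-≤ !xs xs⊆ys─x) ⟩
    suc (length (ys ─ x∈ys)) ≡⟨ sym (length-removeAt′ ys (index x∈ys)) ⟩
    length ys                ∎
    where
    open ≤-Reasoning
    x∈ys : x ∈ ys
    x∈ys = xs⊆ys (here refl)
    xs⊆ys─x : xs ⊆ (ys ─ x∈ys)
    xs⊆ys─x y∈xs = ∈-─⁺ x∈ys (xs⊆ys (there y∈xs)) (≢-sym (All.lookup x∉xs y∈xs))

module _ {ℓ : Level} {Σ : Set ℓ} (_≟_ : DecidableEquality Σ) where
  open Strings _≟_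

  IsPrefix⇒Substr : ∀ {T u} → IsPrefix T u → Substr T u
  IsPrefix⇒Substr (r , T≡u++r) = [] , r , T≡u++r

  Substr⇒⊆ : ∀ {T u} → Substr T u → u ⊆ T
  Substr⇒⊆ (l , r , refl) c∈u = ∈-++⁺ʳ l (∈-++⁺ˡ c∈u)

  Infix⇒Substr : ∀ {T u} → Infix _≡_ u T → Substr T u
  Infix⇒Substr i with MkView l u≈v r ← toView i rewrite Pointwise-≡⇒≡ u≈v = l , r , refl

  Substr⇒Infix : ∀ {T u} → Substr T u → Infix _≡_ u T
  Substr⇒Infix (l , r , refl) = fromView (MkView l (≡⇒Pointwise-≡ refl) r)

  Substr-∷⁻ : ∀ {a T u} → Substr (a ∷ T) u → IsPrefix (a ∷ T) u ⊎ Substr T u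
  Substr-∷⁻ ([]    , r , aT≡u++r) = inj₁ (r , aT≡u++r)
  Substr-∷⁻ (_ ∷ l , r , refl)     = inj₂ (l , r , refl)

  Substr-drop-head : ∀ {a b T u} → Substr (a ∷ T) (b ∷ u) → Substr T u
  Substr-drop-head ([]        , r , refl) = [] , r , refl
  Substr-drop-head {b = b} (_ ∷ l , r , refl) = l ++ [ b ] , r , sym (++-assoc l [ b ] _)

  IsPrefix-∷⁻ : ∀ {a b T u} → IsPrefix (a ∷ T) (b ∷ u) → IsPrefix T u
  IsPrefix-∷⁻ (r , refl) = r , refl

  IsPrefix-∷ʳ⁻ : ∀ {T u c} → IsPrefix T (u ++ [ c ]) → IsPrefix T u
  IsPrefix-∷ʳ⁻ {u = u} {c} (r , refl) = c ∷ r , ++-assoc u [ c ] r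

  LeftMaximal-∷⁻ : ∀ {a T u} → LeftMaximal (a ∷ T) u → IsPrefix (a ∷ T) u ⊎ LeftMaximal T u
  LeftMaximal-∷⁻ (inj₁ prefix) = inj₁ prefix
  LeftMaximal-∷⁻ (inj₂ (c , d , c≢d , cu , du)) with Substr-∷⁻ cu | Substr-∷⁻ du
  ... | inj₁ cu-prefix | _              = inj₂ (inj₁ (IsPrefix-∷⁻ cu-prefix))
  ... | _              | inj₁ du-prefix = inj₂ (inj₁ (IsPrefix-∷⁻ du-prefix))
  ... | inj₂ cu∈T      | inj₂ du∈T      = inj₂ (inj₂ (c , d , c≢d , cu∈T , du∈T))

  RightMaximal-∷⁻ : ∀ {a T u} → RightMaximal (a ∷ T) u → IsPrefix (a ∷ T) u ⊎ RightMaximal T u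
  RightMaximal-∷⁻ (inj₁ ([]    , refl)) = inj₁ ([] , sym (++-identityʳ _))
  RightMaximal-∷⁻ (inj₁ (_ ∷ l , refl)) = inj₂ (inj₁ (l , refl))
  RightMaximal-∷⁻ (inj₂ (c , d , c≢d , uc , ud)) with Substr-∷⁻ uc | Substr-∷⁻ ud
  ... | inj₁ uc-prefix | _              = inj₁ (IsPrefix-∷ʳ⁻ uc-prefix)
  ... | _              | inj₁ ud-prefix = inj₁ (IsPrefix-∷ʳ⁻ ud-prefix)
  ... | inj₂ uc∈T      | inj₂ ud∈T      = inj₂ (inj₂ (c , d , c≢d , uc∈T , ud∈T))

  M-∷⁻ : ∀ {a T u} → M (a ∷ T) u → IsPrefix (a ∷ T) u ⊎ M T u
  M-∷⁻ (u∈aT , leftMax , rightMax)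
    with Substr-∷⁻ u∈aT | LeftMaximal-∷⁻ leftMax | RightMaximal-∷⁻ rightMax
  ... | inj₁ prefix | _           | _           = inj₁ prefix
  ... | _           | inj₁ prefix | _           = inj₁ prefix
  ... | _           | _           | inj₁ prefix = inj₁ prefix
  ... | inj₂ u∈T    | inj₂ leftT  | inj₂ rightT = inj₂ (u∈T , leftT , rightT)

  RightMaximal-drop-head : ∀ {a b T u} → RightMaximal (a ∷ T) (b ∷ u) → RightMaximal T u
  RightMaximal-drop-head                 (inj₁ ([]    , refl)) = inj₁ ([] , refl)
  RightMaximal-drop-head {b = b} {u = u} (inj₁ (_ ∷ l , refl)) = inj₁ (l ++ [ b ] , sym (++-assoc l [ b ] u))
  RightMaximal-drop-head (inj₂ (c , d , c≢d , buc , bud)) =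
    inj₂ (c , d , c≢d , Substr-drop-head buc , Substr-drop-head bud)

  -- d T w is definitionally the length of extensions T w.
  extensions : String → String → List Σ
  extensions T w = deduplicate _≟_ (filter (λ c → substr? (w ++ [ c ]) T) T)

  extensions-drop-head : ∀ {a b} T u → extensions (a ∷ T) (b ∷ u) ⊆ extensions T u
  extensions-drop-head {a} {b} T u {c} c∈ext
    with _ , buc∈aT ← ∈-filter⁻ (λ c → substr? (b ∷ u ++ [ c ]) (a ∷ T)) (∈-deduplicate⁻ _≟_ _ c∈ext) =
    ∈-deduplicate⁺ _≟_ (∈-filter⁺ (λ c → substr? (u ++ [ c ]) T) c∈T (Substr⇒Infix uc∈T))
    where
    uc∈T : Substr T (u ++ [ c ])
    uc∈T = Substr-drop-head (Infix⇒Substr buc∈aT)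
    c∈T : c ∈ T
    c∈T = Substr⇒⊆ uc∈T (∈-++⁺ʳ u (here refl))

  d-drop-head : ∀ {a b} T u → d (a ∷ T) (b ∷ u) ≤ d T u
  d-drop-head T u = Unique-⊆⇒length-≤ (deduplicate-! _≟_ _) (extensions-drop-head T u)

lemma1 : {Σ : Set} (_≟_ : DecidableEquality Σ) → let open Strings _≟_ in
    (T : String) (a : Σ) (x : String) →
    ¬ M T (a ∷ x) → M (a ∷ T) (a ∷ x) →
    M T x × d (a ∷ T) (a ∷ x) ≤ d T x
lemma1 _≟_ T a x ax∉M[T] ax∈M[aT]@(_ , _ , ax-rightMax) =
  (IsPrefix⇒Substr _≟_ x-prefix , inj₁ x-prefix , RightMaximal-drop-head _≟_ ax-rightMax) ,
  d-drop-head _≟_ T x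
  where
  open Strings _≟_
  x-prefix : IsPrefix T x
  x-prefix with M-∷⁻ _≟_ ax∈M[aT]
  ... | inj₁ ax-prefix = IsPrefix-∷⁻ _≟_ ax-prefix
  ... | inj₂ ax∈M[T]   = contradiction ax∈M[T] ax∉M[T]
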